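{- Let $R$ be a binary relation on a set $X$. If $R$ is symmetric and satisfies semi-order property 1, then its complement $R^C=(X\times X)\setminus R$ also satisfies semi-order property 1.
   Context: Write $xRy$ for $(x,y)\in R$. Symmetric: $xRy\to yRx$ for all $x,y$. Semi-order property 1: for all $w,x,y,z\in X$, $wRx\land\lnot xRy\land\lnot yRx\land yRz\to wRz$. -}

module Defs where

open import Level using (Level)
open import Relation.Binary.Core using (Rel)
open import Relation.Nullary using (¬_)

SemiOrder1 : ∀ {a ℓ} {X : Set a} → Rel X ℓ → Set _
SemiOrder1 {X = X} R =
  ∀ (w x y z : X) → R w x → ¬ R x y → ¬ R y x → R y z → R w z

Complement : ∀ {a ℓ} {X : Set a} → Rel X ℓ → Rel X ℓ
Complement R x y = ¬ R x y

-- Suppose ¬ w R x, ¬ ¬ x R y, ¬ y R z, but w R z. Then x R y holds (refuting it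
-- contradicts ¬ ¬ x R y), and property 1 of R applied to z R w, ¬ w R x, ¬ x R w,
-- x R y yields z R y, i.e. y R z by symmetry: a contradiction.
module Submission where

open import Defs
open import Relation.Binary.Core using (Rel)
open import Relation.Binary.Definitions using (Symmetric)
open import Relation.Nullary using (¬_)

module _ {a ℓ} {X : Set a} (R : Rel X ℓ) (sym : Symmetric R) (so : SemiOrder1 R) where

  semiOrder1-via-unrelated : ∀ {w x y z} → ¬ R w x → R w z → R x y → R y z
  semiOrder1-via-unrelated {w} {x} {y} {z} ¬wRx wRz xRy =
    sym (so z w x y (sym wRz) ¬wRx (λ xRw → ¬wRx (sym xRw)) xRy)

mainTheorem9 : ∀ {a ℓ} {X : Set a} (R : Rel X ℓ) →
    Symmetric R → SemiOrder1 R → SemiOrder1 (Complement R)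
mainTheorem9 R sym so w x y z ¬wRx ¬¬xRy _ ¬yRz wRz =
  ¬¬xRy (λ xRy → ¬yRz (semiOrder1-via-unrelated R sym so ¬wRx wRz xRy))
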